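{- Let $F$ be a recursively enumerable formal system in which infinitely many different theorems can be proved, and let $f_F$ and $\mathcal{F}_{\mathrm{step}}$ be as in the context. Then $f_F$ admits a finite teaching set in $\mathcal{F}_{\mathrm{step}}$ if and only if $F$ is inconsistent.
   Context: $\mathbb{N}=\{0,1,2,\dots\}$. A formal system $F$ is consistent if no statement is provable together with its negation, inconsistent otherwise. Fix a Gödel numbering in which translating statements and forming negations is primitive recursive. $F$ is recursively enumerable if there is a primitive recursive $\varphi:\mathbb{N}\to\mathbb{N}$ whose range is exactly the set of Gödel numbers of statements provable in $F$; fix such $\varphi$. Define $f_F:\mathbb{N}\to\{0,1\}$ by $f_F(n)=0$ if $\varphi(1),\dots,\varphi(n)$ are consistent and $f_F(n)=1$ otherwise, where $\varphi(1),\dots,\varphi(n)$ are inconsistent iff for some $1\le i,j\le n$ the statement $\varphi(i)$ is the negation of $\varphi(j)$. With $\operatorname{sgn}(x)=1$ for $x\ge0$ and $0$ for $x<0$, let $\mathcal{F}_{\mathrm{step}}=\{n\mapsto\operatorname{sgn}(n-k): k\in\mathbb{N}\}\cup\{0\}$. For $g\in\mathcal{G}\subseteq\{0,1\}^{\mathbb{N}}$, a set $S\subseteq\mathbb{N}\times\{0,1\}$ is a teaching set for $g$ in $\mathcal{G}$ if $g(x)=y$ for all $(x,y)\in S$ and every $\tilde g\in\mathcal{G}\setminus\{g\}$ has $\tilde g(x)\ne y$ for some $(x,y)\in S$. -}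

module Defs where

open import Data.Nat using (ℕ; zero; suc; _≤_; _<_; _≡ᵇ_; _≤ᵇ_)
open import Data.Bool using (Bool; true; false)
open import Data.Fin using (Fin)
open import Data.Vec using (Vec; []; _∷_; lookup; map)
open import Data.List using (List; upTo)
open import Data.Bool.ListAction using (any)
import Data.List as List
open import Data.List.Membership.Propositional using (_∈_)
open import Data.Product using (Σ; ∃; _×_; _,_; ∃-syntax)
open import Data.Sum using (_⊎_)
open import Relation.Nullary using (¬_)
open import Relation.Binary.PropositionalEquality using (_≡_; _≢_)

data PR : ℕ → Set where
  zeroF : PR 0
  succF : PR 1
  projF : ∀ {n} → Fin n → PR n
  compF : ∀ {n m} → PR m → Vec (PR n) m → PR n
  recF  : ∀ {n} → PR n → PR (suc (suc n)) → PR (suc n)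

mutual
  eval : ∀ {n} → PR n → Vec ℕ n → ℕ
  eval zeroF      _        = 0
  eval succF      (x ∷ []) = suc x
  eval (projF i)  xs       = lookup xs i
  eval (compF g hs) xs     = eval g (evalAll hs xs)
  eval (recF g h) (zero  ∷ xs) = eval g xs
  eval (recF g h) (suc y ∷ xs) = eval h (eval (recF g h) (y ∷ xs) ∷ y ∷ xs)

  evalAll : ∀ {n m} → Vec (PR n) m → Vec ℕ n → Vec ℕ m
  evalAll []       xs = []
  evalAll (h ∷ hs) xs = eval h xs ∷ evalAll hs xs

IsPrimRec : (ℕ → ℕ) → Set
IsPrimRec f = Σ (PR 1) λ c → ∀ x → eval c (x ∷ []) ≡ f x

-- Recursively enumerable formal systems, given via Gödel numbers:
-- `neg` forms (the Gödel number of) the negation, `φ` is the fixed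
-- primitive recursive enumeration of the provable statements.
-- Following the definition of f_F (which uses φ(1),…,φ(n)), the
-- enumeration is indexed from 1: the provable statements are φ(i), i ≥ 1.

record REFormalSystem : Set where
  field
    neg    : ℕ → ℕ
    neg-pr : IsPrimRec neg
    φ      : ℕ → ℕ
    φ-pr   : IsPrimRec φ

  Provable : ℕ → Set
  Provable s = ∃[ i ] (1 ≤ i × φ i ≡ s)

  Inconsistent : Set
  Inconsistent = ∃[ s ] (Provable s × Provable (neg s))

  Consistent : Set
  Consistent = ¬ Inconsistent

  InfinitelyManyTheorems : Set
  InfinitelyManyTheorems = ∀ m → ∃[ s ] (Provable s × m < s)

  oneTo : ℕ → List ℕ
  oneTo n = List.map suc (upTo n)

  inconsistentUpTo : ℕ → Bool
  inconsistentUpTo n =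
    any (λ i → any (λ j → φ i ≡ᵇ neg (φ j)) (oneTo n)) (oneTo n)

  f : ℕ → Bool
  f n = inconsistentUpTo n

-- Concept classes of {0,1}-valued functions (0 = false, 1 = true)

Class : Set₁
Class = (ℕ → Bool) → Set

-- sgn(n - k) = 1 iff n - k ≥ 0 iff k ≤ n
stepFn : ℕ → ℕ → Bool
stepFn k n = k ≤ᵇ n

zeroFn : ℕ → Bool
zeroFn _ = false

Fstep : Class
Fstep g = (∀ n → g n ≡ zeroFn n) ⊎ (∃[ k ] ∀ n → g n ≡ stepFn k n)

_≗'_ : (ℕ → Bool) → (ℕ → Bool) → Set
g ≗' h = ∀ n → g n ≡ h n

IsTeachingSet : Class → (ℕ → Bool) → List (ℕ × Bool) → Set
IsTeachingSet G g S =
  (∀ {x y} → (x , y) ∈ S → g x ≡ y) ×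
  (∀ g̃ → G g̃ → ¬ (g̃ ≗' g) → ∃[ x ] ∃[ y ] ((x , y) ∈ S × g̃ x ≢ y))

HasFiniteTeachingSet : Class → (ℕ → Bool) → Set
HasFiniteTeachingSet G g = ∃[ S ] IsTeachingSet G g S

-- f_F is false at 0 and stays true once an inconsistency has been enumerated, so it
-- is either the zero function (F consistent) or a step function sgn(n − k) with
-- k ≥ 1 (F inconsistent). A step function with k ≥ 1 is taught by the two points
-- (k − 1, 0) and (k, 1). The zero function has no finite teaching set: beyond the
-- largest point of a candidate set S, the step function sgn(n − b) agrees with 0
-- on all of S.
module Submission where

open import Defs
open import Function.Bundles using (_⇔_; mk⇔; Equivalence)
open import Data.Nat using (ℕ; zero; suc; _≤_; _<_; _≤ᵇ_; z≤n; s≤s; _⊔_)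
open import Data.Nat.Properties
  using (≤ᵇ⇒≤; ≤⇒≤ᵇ; <⇒≱; <⇒≤; ≤-refl; ≤-trans; <-cmp; m≤m⊔n; m≤n⊔m; ≡ᵇ⇒≡; ≡⇒≡ᵇ)
open import Data.Bool using (Bool; true; false)
open import Data.Bool.Properties using (T-≡)
open import Data.Bool.ListAction using (any)
open import Data.List using (List; []; _∷_)
open import Data.List.Membership.Propositional using (_∈_; find; lose)
open import Data.List.Membership.Propositional.Properties using (∈-map⁺; ∈-map⁻; ∈-upTo⁺; ∈-upTo⁻)
open import Data.List.Relation.Unary.Any using (here; there)
open import Data.List.Relation.Unary.Any.Properties using (any⁺; any⁻)
open import Data.Product using (_×_; _,_; ∃-syntax; proj₁)
open import Data.Sum using (inj₁; inj₂)
open import Relation.Nullary using (¬_; contradiction)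
open import Relation.Binary using (tri<; tri≈; tri>)
open import Relation.Binary.PropositionalEquality

private
  true≢false : true ≢ false
  true≢false ()

any≡true⁻ : ∀ {A : Set} (p : A → Bool) xs → any p xs ≡ true → ∃[ x ] (x ∈ xs × p x ≡ true)
any≡true⁻ p xs eq with find (any⁻ p xs (Equivalence.from T-≡ eq))
... | x , x∈xs , px = x , x∈xs , Equivalence.to T-≡ px

any≡true⁺ : ∀ {A : Set} (p : A → Bool) {xs x} → x ∈ xs → p x ≡ true → any p xs ≡ true
any≡true⁺ p x∈xs px = Equivalence.to T-≡ (any⁺ p (lose x∈xs (Equivalence.from T-≡ px)))

stepFn-< : ∀ {k x} → x < k → stepFn k x ≡ false
stepFn-< {k} {x} x<k with k ≤ᵇ x in eq
... | false = refl
... | true  = contradiction (≤ᵇ⇒≤ k x (Equivalence.from T-≡ eq)) (<⇒≱ x<k)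

stepFn-≥ : ∀ {k x} → k ≤ x → stepFn k x ≡ true
stepFn-≥ k≤x = Equivalence.to T-≡ (≤⇒≤ᵇ k≤x)

IsTeachingSet-resp-≗ : ∀ {G g h S} → h ≗' g → IsTeachingSet G g S → IsTeachingSet G h S
IsTeachingSet-resp-≗ h≗g (agrees , separates) =
    (λ x,y∈S → trans (h≗g _) (agrees x,y∈S))
  , (λ g̃ g̃∈G g̃≉h → separates g̃ g̃∈G (λ g̃≗g → g̃≉h (λ n → trans (g̃≗g n) (sym (h≗g n)))))

stepFn-teachingSet : ∀ k → IsTeachingSet Fstep (stepFn (suc k)) ((k , false) ∷ (suc k , true) ∷ [])
stepFn-teachingSet k = agrees , separates
  where
  agrees : ∀ {x y} → (x , y) ∈ (k , false) ∷ (suc k , true) ∷ [] → stepFn (suc k) x ≡ y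
  agrees (here refl)         = stepFn-< {suc k} {k} ≤-refl
  agrees (there (here refl)) = stepFn-≥ {suc k} ≤-refl

  separates : ∀ g̃ → Fstep g̃ → ¬ (g̃ ≗' stepFn (suc k)) →
              ∃[ x ] ∃[ y ] ((x , y) ∈ (k , false) ∷ (suc k , true) ∷ [] × g̃ x ≢ y)
  separates g̃ (inj₁ g̃≗0) _ =
    suc k , true , there (here refl) , λ g̃k≡true → true≢false (trans (sym g̃k≡true) (g̃≗0 (suc k)))
  separates g̃ (inj₂ (k′ , g̃≗step)) g̃≉step with <-cmp k′ (suc k)
  ... | tri< (s≤s k′≤k) _ _ =
    k , false , here refl ,
    λ g̃k≡false → true≢false (trans (sym (trans (g̃≗step k) (stepFn-≥ k′≤k))) g̃k≡false)
  ... | tri≈ _ refl _ = contradiction g̃≗step g̃≉step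
  ... | tri> _ _ k<k′ =
    suc k , true , there (here refl) ,
    λ g̃k≡true → true≢false (trans (sym g̃k≡true) (trans (g̃≗step (suc k)) (stepFn-< k<k′)))

UpwardClosed : (ℕ → Bool) → Set
UpwardClosed g = ∀ {m n} → m ≤ n → g m ≡ true → g n ≡ true

-- Induction on a point where g is true: the last false point below it is the jump.
upwardClosed⇒step : ∀ {g} → UpwardClosed g → g 0 ≡ false → ∀ {n} → g n ≡ true →
                    ∃[ k ] (g ≗' stepFn (suc k))
upwardClosed⇒step g↑ g0≡false {zero} g0≡true = contradiction (trans (sym g0≡true) g0≡false) true≢false
upwardClosed⇒step {g} g↑ g0≡false {suc m} gn≡true with g m in gm
... | true  = upwardClosed⇒step g↑ g0≡false gm
... | false = m , jumpsAt
  where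
  jumpsAt : g ≗' stepFn (suc m)
  jumpsAt x with <-cmp x (suc m)
  ... | tri< (s≤s x≤m) _ _ with g x in gx
  ...   | true  = contradiction (trans (sym (g↑ x≤m gx)) gm) true≢false
  ...   | false = sym (stepFn-< (s≤s x≤m))
  jumpsAt x | tri≈ _ refl _ = trans gn≡true (sym (stepFn-≥ {suc m} ≤-refl))
  jumpsAt x | tri> _ _ sm<x = trans (g↑ (<⇒≤ sm<x) gn≡true) (sym (stepFn-≥ (<⇒≤ sm<x)))

fstBound : List (ℕ × Bool) → ℕ
fstBound []             = 0
fstBound ((x , _) ∷ S) = suc x ⊔ fstBound S

∈⇒<fstBound : ∀ {S x y} → (x , y) ∈ S → x < fstBound S
∈⇒<fstBound {(x , _) ∷ S} (here refl)  = m≤m⊔n (suc x) (fstBound S)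
∈⇒<fstBound {(x , _) ∷ S} (there x,y∈S) = ≤-trans (∈⇒<fstBound x,y∈S) (m≤n⊔m (suc x) (fstBound S))

teachable⇒∃true : ∀ {g} → HasFiniteTeachingSet Fstep g → ∃[ x ] g x ≡ true
teachable⇒∃true {g} (S , agrees , separates) with g (fstBound S) in gb
... | true  = fstBound S , gb
... | false with separates (stepFn (fstBound S)) (inj₂ (fstBound S , λ _ → refl)) step≉g
  where
  step≉g : ¬ (stepFn (fstBound S) ≗' g)
  step≉g step≗g =
    true≢false (trans (sym (stepFn-≥ {fstBound S} ≤-refl)) (trans (step≗g (fstBound S)) gb))
... | x , false , x,y∈S , stepx≢false = contradiction (stepFn-< (∈⇒<fstBound x,y∈S)) stepx≢false
... | x , true  , x,y∈S , _           = x , agrees x,y∈S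

module _ (F : REFormalSystem) where
  open REFormalSystem F

  ∈-oneTo⁻ : ∀ {n i} → i ∈ oneTo n → 1 ≤ i × i ≤ n
  ∈-oneTo⁻ i∈ with ∈-map⁻ suc i∈
  ... | _ , j∈upTo , refl = s≤s z≤n , ∈-upTo⁻ j∈upTo

  ∈-oneTo⁺ : ∀ {n i} → 1 ≤ i → i ≤ n → i ∈ oneTo n
  ∈-oneTo⁺ {i = suc j} _ i≤n = ∈-map⁺ suc (∈-upTo⁺ i≤n)

  ContradictoryPairUpTo : ℕ → Set
  ContradictoryPairUpTo n = ∃[ i ] ∃[ j ] (i ∈ oneTo n × j ∈ oneTo n × φ i ≡ neg (φ j))

  f⇒contradictoryPair : ∀ n → f n ≡ true → ContradictoryPairUpTo n
  f⇒contradictoryPair n fn with any≡true⁻ _ (oneTo n) fn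
  ... | i , i∈ , anyj with any≡true⁻ _ (oneTo n) anyj
  ... | j , j∈ , φi≡ᵇ¬φj = i , j , i∈ , j∈ , ≡ᵇ⇒≡ _ _ (Equivalence.from T-≡ φi≡ᵇ¬φj)

  contradictoryPair⇒f : ∀ n → ContradictoryPairUpTo n → f n ≡ true
  contradictoryPair⇒f _ (i , j , i∈ , j∈ , φi≡¬φj) =
    any≡true⁺ _ i∈ (any≡true⁺ _ j∈ (Equivalence.to T-≡ (≡⇒≡ᵇ _ _ φi≡¬φj)))

  f-upwardClosed : UpwardClosed f
  f-upwardClosed {n} {m} n≤m fn with f⇒contradictoryPair n fn
  ... | i , j , i∈ , j∈ , φi≡¬φj = contradictoryPair⇒f m (i , j , widen i∈ , widen j∈ , φi≡¬φj)
    where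
    widen : ∀ {l} → l ∈ oneTo n → l ∈ oneTo m
    widen l∈ = let 1≤l , l≤n = ∈-oneTo⁻ l∈ in ∈-oneTo⁺ 1≤l (≤-trans l≤n n≤m)

  f⇒inconsistent : ∀ n → f n ≡ true → Inconsistent
  f⇒inconsistent n fn with f⇒contradictoryPair n fn
  ... | i , j , i∈ , j∈ , φi≡¬φj =
    φ j , (j , proj₁ (∈-oneTo⁻ j∈) , refl) , (i , proj₁ (∈-oneTo⁻ i∈) , φi≡¬φj)

  inconsistent⇒f : Inconsistent → ∃[ n ] f n ≡ true
  inconsistent⇒f (s , (i , 1≤i , φi≡s) , (j , 1≤j , φj≡¬s)) =
    i ⊔ j , contradictoryPair⇒f (i ⊔ j)
      ( j , i , ∈-oneTo⁺ 1≤j (m≤n⊔m i j) , ∈-oneTo⁺ 1≤i (m≤m⊔n i j)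
      , trans φj≡¬s (cong neg (sym φi≡s)))

proposition3p2 : (F : REFormalSystem) →
    REFormalSystem.InfinitelyManyTheorems F →
    (HasFiniteTeachingSet Fstep (REFormalSystem.f F) ⇔ REFormalSystem.Inconsistent F)
proposition3p2 F _ = mk⇔ teachable⇒inconsistent inconsistent⇒teachable
  where
  open REFormalSystem F using (f; Inconsistent)

  teachable⇒inconsistent : HasFiniteTeachingSet Fstep f → Inconsistent
  teachable⇒inconsistent teachable with teachable⇒∃true teachable
  ... | x , fx = f⇒inconsistent F x fx

  inconsistent⇒teachable : Inconsistent → HasFiniteTeachingSet Fstep f
  inconsistent⇒teachable inc with inconsistent⇒f F inc
  ... | n , fn with upwardClosed⇒step (f-upwardClosed F) refl {n} fn
  ... | k , f≗step = _ , IsTeachingSet-resp-≗ f≗step (stepFn-teachingSet k)
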